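{- Let $k$ be a positive integer and let $G$ be a $k$-tree of order $n$ with an addition ordering $v_1,v_2,\dots,v_n$. Let $i\in\{k+1,\dots,n\}$, let $V_i=N_G(v_i)\cap\{v_j\mid 1\le j\le i-1\}$, let $B=B(V_i,v_i)$, and let $u_0,u_1,\dots,u_s$ be the ordering of $V(B)\setminus V_i$ induced from the addition ordering of $G$. Then (a) $u_0=v_i$; (b) $\bigl|N_B(u_j)\cap(V_i\cup\{u_\ell\mid 0\le\ell\le j-1\})\bigr|=k$ for every $j\in[s]$; and (c) $\bigl|V_i\cap\bigcap_{\ell=1}^{j}N_B(u_\ell)\bigr|\ge\bigl|V_i\cap\bigcap_{\ell=1}^{j-1}N_B(u_\ell)\bigr|-1$ for every $j\in[s]$ (where the empty intersection $\bigcap_{\ell=1}^{0}N_B(u_\ell)$ is understood as imposing no restriction, i.e. $V_i\cap\bigcap_{\ell=1}^{0}N_B(u_\ell)=V_i$).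
   Context: For a positive integer $k$, a graph $G$ is a $k$-tree if there is a sequence $G_0,\dots,G_s$ of induced subgraphs of $G$ with $G_0\cong K_{k+1}$, $G_s=G$, and for each $t\in[s]$, $V(G_t)=V(G_{t-1})\cup\{x_t\}$ for a new vertex $x_t$ whose neighbors in $V(G_{t-1})$ form a clique of order $k$. An addition ordering of $G$ is an ordering $v_1,\dots,v_n$ of $V(G)$ with $v_1,\dots,v_{k+1}$ the vertices of $G_0$ and $v_{t+k+1}=x_t$; in particular for $i\ge k+1$ the set $N_G(v_i)\cap\{v_1,\dots,v_{i-1}\}$ is a clique of order $k$. For a clique $V$ of order $k$ of $G$ and a vertex $u\in\bigcap_{v\in V}N_G(v)$, the branch $B(V,u)$ is the subgraph of $G$ induced by $V\cup V(G_u)$, where $G_u$ is the component of $G-V$ containing $u$. $N_B(x)$ is the neighborhood of $x$ in $B$. -}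

module Defs where

open import Data.Nat using (ℕ; zero; suc; _≤_; _<_; pred)
open import Data.Fin as Fin using (Fin; toℕ)
open import Data.List using (List; length)
open import Data.List.Membership.Propositional using (_∈_)
open import Data.List.Relation.Unary.Unique.Propositional using (Unique)
open import Data.Product using (Σ; ∃; _×_; _,_)
open import Data.Sum using (_⊎_)
open import Relation.Nullary using (¬_)
open import Relation.Binary using (Decidable)
open import Relation.Binary.PropositionalEquality using (_≡_; _≢_)
open import Function.Definitions using (Injective)

record Graph (n : ℕ) : Set₁ where
  field
    Adj    : Fin n → Fin n → Set
    adj?   : Decidable Adj
    sym    : ∀ {x y} → Adj x y → Adj y x
    irrefl : ∀ {x} → ¬ Adj x x
open Graph public

VSet : ℕ → Set₁
VSet n = Fin n → Set

Card : ∀ {n} → VSet n → ℕ → Set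
Card {n} P m = Σ (List (Fin n)) λ xs →
  Unique xs × (∀ x → (P x → x ∈ xs) × (x ∈ xs → P x)) × length xs ≡ m

IsClique : ∀ {n} → Graph n → VSet n → ℕ → Set
IsClique G S m = Card S m × (∀ x y → S x → S y → x ≢ y → Adj G x y)

Earlier : ∀ {n} → (Fin n → Fin n) → Fin n → VSet n
Earlier v i x = ∃ λ j → j Fin.< i × x ≡ v j

BackNbhd : ∀ {n} → Graph n → (Fin n → Fin n) → Fin n → VSet n
BackNbhd G v i x = Adj G (v i) x × Earlier v i x

-- v is an addition ordering of the k-tree G (positions 0-indexed:
-- position p corresponds to the paper's v_{p+1}).
record AdditionOrdering {n : ℕ} (k : ℕ) (G : Graph n) (v : Fin n → Fin n) : Set where
  field
    bijective : Injective _≡_ _≡_ v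
    size      : suc k ≤ n
    base      : ∀ p q → toℕ p ≤ k → toℕ q ≤ k → p ≢ q → Adj G (v p) (v q)
    step      : ∀ i → k ≤ toℕ i → IsClique G (BackNbhd G v i) k

data WalkAvoid {n} (G : Graph n) (S : VSet n) : Fin n → Fin n → Set where
  here  : ∀ {x} → ¬ S x → WalkAvoid G S x x
  there : ∀ {x y z} → ¬ S x → Adj G x y → WalkAvoid G S y z → WalkAvoid G S x z

-- Vertex set of the branch B(V,u): V ∪ V(G_u), G_u the component of
-- G - V containing u.
BranchV : ∀ {n} → Graph n → VSet n → Fin n → VSet n
BranchV G V u x = V x ⊎ WalkAvoid G V u x

NB : ∀ {n} → Graph n → VSet n → Fin n → Fin n → VSet n
NB G V u x y = Adj G x y × BranchV G V u y

CommonNbhd : ∀ {n s} → Graph n → VSet n → Fin n → (Fin (suc s) → Fin n) → ℕ → VSet n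
CommonNbhd {s = s} G V u w m x =
  V x × (∀ (ℓ : Fin (suc s)) → 1 ≤ toℕ ℓ → toℕ ℓ ≤ m → NB G V u (w ℓ) x)

{-# OPTIONS --safe #-}
-- Call a position p a descendant of i if v_p is reached from v_i along edges that go forward in the
-- addition ordering.  The earlier neighbours of any vertex form a clique, so an earlier neighbour of a
-- descendant is again a descendant or lies in V_i; hence every vertex of B outside V_i is a descendant
-- and comes after v_i.  This gives (a), and shows that the earlier neighbours of u_j lie in
-- V_i ∪ {u_0, …, u_{j-1}}, which is (b).  For (c): a k-tree has no clique of order k + 2 (all members
-- of a clique are earlier neighbours of its last one), yet two vertices of V_i ∩ N(u_1) ∩ … ∩ N(u_{j-1})
-- not adjacent to u_j would form one together with the k earlier neighbours of u_j.
module Submission where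

open import Defs
open import Data.Nat using (ℕ; suc; pred; _≤_; _<_; z≤n; s≤s; z<s)
import Data.Nat.Properties as ℕ
open import Data.Fin as Fin using (Fin; toℕ; fromℕ<; punchOut; _≟_)
import Data.Fin.Properties as Finₚ
open import Data.List using (List; []; _∷_; length)
open import Data.List.Membership.Propositional using (_∈_; find; lose)
open import Data.List.Relation.Binary.Subset.Propositional using (_⊆_)
open import Data.List.Relation.Unary.Any using (here; there; any?)
open import Data.List.Relation.Unary.All as All using (_∷_)
open import Data.List.Relation.Unary.AllPairs as AllPairs using (AllPairs; []; _∷_)
open import Data.List.Relation.Unary.Unique.Propositional using (Unique)
open import Data.List.Extrema.Nat using (argmax; argmax-sel; f[⊥]≤f[argmax]; f[xs]≤f[argmax])
open import Data.Product using (∃; _×_; _,_; proj₁; proj₂)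
open import Data.Sum using (_⊎_; inj₁; inj₂; fromInj₂)
open import Function using (_∘_)
open import Function.Definitions using (Injective)
open import Relation.Binary using (Rel; Symmetric; tri<; tri≈; tri>)
open import Relation.Nullary using (¬_; Dec; yes; no; ¬?; contradiction)
open import Relation.Nullary.Decidable using (decidable-stable; _×-dec_)
open import Relation.Unary using (Pred; Decidable)
open import Relation.Binary.PropositionalEquality
  using (_≡_; _≢_; refl; trans; cong; subst; subst₂) renaming (sym to ≡-sym)

module _ {a} {A : Set a} where

  remove : ∀ {x : A} (ys : List A) → x ∈ ys → List A
  remove (_ ∷ ys) (here _)  = ys
  remove (y ∷ ys) (there p) = y ∷ remove ys p

  length-remove : ∀ {x : A} (ys : List A) (p : x ∈ ys) → length ys ≡ suc (length (remove ys p))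
  length-remove (_ ∷ ys) (here _)  = refl
  length-remove (y ∷ ys) (there p) = cong suc (length-remove ys p)

  ∈-remove : ∀ {x z : A} {ys} (p : x ∈ ys) → z ∈ ys → z ≢ x → z ∈ remove ys p
  ∈-remove (here refl) (here refl) z≢x = contradiction refl z≢x
  ∈-remove (here refl) (there q)   _   = q
  ∈-remove (there p)   (here refl) _   = here refl
  ∈-remove (there p)   (there q)   z≢x = there (∈-remove p q z≢x)

  Unique-⊆⇒length≤ : ∀ {xs ys : List A} → Unique xs → xs ⊆ ys → length xs ≤ length ys
  Unique-⊆⇒length≤ {[]}     _            _     = z≤n
  Unique-⊆⇒length≤ {x ∷ xs} {ys} (x∉xs ∷ xs!) xs⊆ys =
    subst (suc (length xs) ≤_) (≡-sym (length-remove ys x∈ys))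
      (s≤s (Unique-⊆⇒length≤ xs! λ z∈xs →
        ∈-remove x∈ys (xs⊆ys (there z∈xs)) (All.lookup x∉xs z∈xs ∘ ≡-sym)))
    where
    x∈ys : x ∈ ys
    x∈ys = xs⊆ys (here refl)

  ⊆-but-one⇒length≤suc : ∀ {p} {P : Pred A p} → Decidable P → ∀ {xs ys : List A} → Unique xs →
    (∀ {x y} → x ∈ xs → y ∈ xs → ¬ P x → ¬ P y → x ≡ y) →
    (∀ {x} → x ∈ xs → P x → x ∈ ys) →
    length xs ≤ suc (length ys)
  ⊆-but-one⇒length≤suc P? {xs} {ys} xs! ¬P-unique P⇒∈ys with any? (¬? ∘ P?) xs
  ... | no ∄¬P = ℕ.≤-trans (Unique-⊆⇒length≤ xs! xs⊆ys) (ℕ.n≤1+n _)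
    where
    xs⊆ys : xs ⊆ ys
    xs⊆ys {x} x∈xs = P⇒∈ys x∈xs (decidable-stable (P? x) (∄¬P ∘ lose x∈xs))
  ... | yes ∃¬P with x₀ , x₀∈xs , ¬Px₀ ← find ∃¬P = Unique-⊆⇒length≤ xs! xs⊆x₀∷ys
    where
    xs⊆x₀∷ys : xs ⊆ x₀ ∷ ys
    xs⊆x₀∷ys {x} x∈xs with P? x
    ... | yes Px = there (P⇒∈ys x∈xs Px)
    ... | no ¬Px = here (¬P-unique x∈xs x₀∈xs ¬Px ¬Px₀)

  AllPairs-lookup : ∀ {r} {R : Rel A r} → Symmetric R → ∀ {xs} → AllPairs R xs →
    ∀ {x y} → x ∈ xs → y ∈ xs → x ≢ y → R x y
  AllPairs-lookup _     (_ ∷ _)   (here refl) (here refl) x≢y = contradiction refl x≢y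
  AllPairs-lookup _     (Rx ∷ _)  (here refl) (there y∈)  _   = All.lookup Rx y∈
  AllPairs-lookup R-sym (Ry ∷ _)  (there x∈)  (here refl) _   = R-sym (All.lookup Ry x∈)
  AllPairs-lookup R-sym (_ ∷ Rxs) (there x∈)  (there y∈)  x≢y = AllPairs-lookup R-sym Rxs x∈ y∈ x≢y

  pairwise⇒AllPairs : ∀ {r} {R : Rel A r} {xs} → Unique xs →
    (∀ {x y} → x ∈ xs → y ∈ xs → x ≢ y → R x y) → AllPairs R xs
  pairwise⇒AllPairs []           _    = []
  pairwise⇒AllPairs (x∉xs ∷ xs!) R-xs =
    All.tabulate (λ y∈xs → R-xs (here refl) (there y∈xs) (All.lookup x∉xs y∈xs))
    ∷ pairwise⇒AllPairs xs! (λ x∈ y∈ → R-xs (there x∈) (there y∈))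

injective⇒preimage : ∀ {n} {f : Fin n → Fin n} → Injective _≡_ _≡_ f → ∀ y → ∃ λ x → f x ≡ y
injective⇒preimage {suc m} {f} f-inj y with Finₚ.any? (λ x → f x ≟ y)
... | yes found = found
... | no  ∄x    = contradiction (Finₚ.injective⇒≤ {f = g} g-inj) ℕ.1+n≰n
  where
  y≢f : ∀ x → y ≢ f x
  y≢f x y≡fx = ∄x (x , ≡-sym y≡fx)

  g : Fin (suc m) → Fin m
  g x = punchOut (y≢f x)

  g-inj : Injective _≡_ _≡_ g
  g-inj {a} {b} = f-inj ∘ Finₚ.punchOut-injective (y≢f a) (y≢f b)

Card-cong : ∀ {n} {P Q : VSet n} {m} → (∀ {x} → P x → Q x) → (∀ {x} → Q x → P x) →
  Card P m → Card Q m
Card-cong P⇒Q Q⇒P (xs , xs! , xs-mem , len) =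
  xs , xs! , (λ x → proj₁ (xs-mem x) ∘ Q⇒P , P⇒Q ∘ proj₂ (xs-mem x)) , len

module _ {n} {G : Graph n} {S : VSet n} where

  walkAvoid-source : ∀ {x y} → WalkAvoid G S x y → ¬ S x
  walkAvoid-source (here ¬Sx)      = ¬Sx
  walkAvoid-source (there ¬Sx _ _) = ¬Sx

  walkAvoid-snoc : ∀ {x y z} → WalkAvoid G S x y → Adj G y z → ¬ S z → WalkAvoid G S x z
  walkAvoid-snoc (here ¬Sy)        y~z ¬Sz = there ¬Sy y~z (here ¬Sz)
  walkAvoid-snoc (there ¬Sx x~w w) y~z ¬Sz = there ¬Sx x~w (walkAvoid-snoc w y~z ¬Sz)

module KTree {k n} {G : Graph n} {v : Fin n → Fin n} (ordering : AdditionOrdering k G v) where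
  open AdditionOrdering ordering

  position : Fin n → Fin n
  position x = proj₁ (injective⇒preimage bijective x)

  v-position : ∀ x → v (position x) ≡ x
  v-position x = proj₂ (injective⇒preimage bijective x)

  position-v : ∀ p → position (v p) ≡ p
  position-v p = bijective (v-position (v p))

  position-injective : ∀ {x y} → position x ≡ position y → x ≡ y
  position-injective {x} {y} eq = trans (≡-sym (v-position x)) (trans (cong v eq) (v-position y))

  Adj-position : ∀ {x y} → Adj G x y → Adj G (v (position x)) (v (position y))
  Adj-position {x} {y} = subst₂ (Adj G) (≡-sym (v-position x)) (≡-sym (v-position y))

  rank : Fin n → ℕ
  rank x = toℕ (position x)

  rank-injective : ∀ {x y} → rank x ≡ rank y → x ≡ y
  rank-injective = position-injective ∘ Finₚ.toℕ-injective

  base-adjacent : ∀ {x y} → rank x ≤ k → rank y ≤ k → x ≢ y → Adj G x y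
  base-adjacent {x} {y} x≤k y≤k x≢y =
    subst₂ (Adj G) (v-position x) (v-position y) (base _ _ x≤k y≤k (x≢y ∘ position-injective))

  backNeighbours-adjacent : ∀ {p q r} → k ≤ toℕ p → q Fin.< p → r Fin.< p →
    Adj G (v p) (v q) → Adj G (v p) (v r) → q ≢ r → Adj G (v q) (v r)
  backNeighbours-adjacent {p} {q} {r} k≤p q<p r<p p~q p~r q≢r =
    proj₂ (step p k≤p) (v q) (v r) (p~q , q , q<p , refl) (p~r , r , r<p , refl) (q≢r ∘ bijective)

  ⊆earlierNeighbours⇒length≤suc : ∀ w → k ≤ rank w → ∀ {xs} → Unique xs →
    (∀ {x} → x ∈ xs → x ≢ w → Adj G w x × rank x < rank w) → length xs ≤ suc k
  ⊆earlierNeighbours⇒length≤suc w k≤w {xs} xs! xs-earlier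
    with (K , _ , K-mem , K-len) , _ ← step (position w) k≤w =
    subst (length xs ≤_) (cong suc K-len) (Unique-⊆⇒length≤ xs! xs⊆w∷K)
    where
    xs⊆w∷K : xs ⊆ w ∷ K
    xs⊆w∷K {x} x∈xs with x ≟ w
    ... | yes x≡w = here x≡w
    ... | no  x≢w with w~x , x<w ← xs-earlier x∈xs x≢w = there (proj₁ (K-mem x)
      (subst (λ u → Adj G u x) (≡-sym (v-position w)) w~x , position x , x<w , ≡-sym (v-position x)))

  clique-length≤ : ∀ {xs} → AllPairs (Adj G) xs → length xs ≤ suc k
  clique-length≤ {xs} xs-clique = ⊆earlierNeighbours⇒length≤suc r k≤rank[r] xs! xs-earlier
    where
    kth : Fin n
    kth = fromℕ< size

    rank[kth] : rank (v kth) ≡ k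
    rank[kth] = trans (cong toℕ (position-v kth)) (Finₚ.toℕ-fromℕ< size)

    -- The default v kth makes r lie at position ≥ k even when the whole clique precedes position k.
    r : Fin n
    r = argmax rank (v kth) xs

    k≤rank[r] : k ≤ rank r
    k≤rank[r] = subst (_≤ rank r) rank[kth] (f[⊥]≤f[argmax] {f = rank} (v kth) xs)

    rank≤rank[r] : ∀ {x} → x ∈ xs → rank x ≤ rank r
    rank≤rank[r] = All.lookup (f[xs]≤f[argmax] {f = rank} (v kth) xs)

    xs! : Unique xs
    xs! = AllPairs.map (λ x~y x≡y → irrefl G (subst (Adj G _) (≡-sym x≡y) x~y)) xs-clique

    xs-earlier : ∀ {x} → x ∈ xs → x ≢ r → Adj G r x × rank x < rank r
    xs-earlier {x} x∈xs x≢r = r~x , rank[x]<rank[r]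
      where
      rank[x]<rank[r] : rank x < rank r
      rank[x]<rank[r] = ℕ.≤∧≢⇒< (rank≤rank[r] x∈xs) (x≢r ∘ rank-injective)

      r~x : Adj G r x
      r~x with argmax-sel rank (v kth) xs
      ... | inj₂ r∈xs     = AllPairs-lookup (sym G) xs-clique r∈xs x∈xs (x≢r ∘ ≡-sym)
      ... | inj₁ r≡v[kth] = base-adjacent (ℕ.≤-reflexive rank[r]≡k)
        (ℕ.<⇒≤ (subst (rank x <_) rank[r]≡k rank[x]<rank[r])) (x≢r ∘ ≡-sym)
        where
        rank[r]≡k : rank r ≡ k
        rank[r]≡k = trans (cong rank r≡v[kth]) rank[kth]

  module Branch (i : Fin n) (k≤i : k ≤ toℕ i) where

    V : VSet n
    V = BackNbhd G v i

    V? : ∀ x → Dec (V x)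
    V? x = adj? G (v i) x ×-dec Finₚ.any? (λ j → (j Finₚ.<? i) ×-dec (x ≟ v j))

    V-adjacent : ∀ {x y} → V x → V y → x ≢ y → Adj G x y
    V-adjacent = proj₂ (step i k≤i) _ _

    ¬V[vi] : ¬ V (v i)
    ¬V[vi] (vi~vi , _) = irrefl G vi~vi

    B∖V : VSet n
    B∖V x = BranchV G V (v i) x × ¬ V x

    branch-extend : ∀ {x y} → B∖V x → Adj G x y → ¬ V y → B∖V y
    branch-extend (inj₁ Vx , ¬Vx) _   _   = contradiction Vx ¬Vx
    branch-extend (inj₂ w  , _)   x~y ¬Vy = inj₂ (walkAvoid-snoc w x~y ¬Vy) , ¬Vy

    data Descendant : Fin n → Set where
      root   : Descendant i
      extend : ∀ {p q} → q Fin.< p → Adj G (v p) (v q) → Descendant q → Descendant p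

    descendant-late : ∀ {p} → Descendant p → toℕ i ≤ toℕ p
    descendant-late root              = ℕ.≤-refl
    descendant-late (extend q<p _ dq) = ℕ.≤-trans (descendant-late dq) (ℕ.<⇒≤ q<p)

    k≤descendant : ∀ {p} → Descendant p → k ≤ toℕ p
    k≤descendant dp = ℕ.≤-trans k≤i (descendant-late dp)

    descendant-backNeighbour : ∀ {p q} → Descendant p → q Fin.< p → Adj G (v p) (v q) →
      V (v q) ⊎ Descendant q
    descendant-backNeighbour root q<i i~q = inj₁ (i~q , _ , q<i , refl)
    descendant-backNeighbour {q = q} dp@(extend {q = y} y<p p~y dy) q<p p~q with Finₚ.<-cmp q y
    ... | tri≈ _ refl _ = inj₂ dy
    ... | tri< q<y _ _  = descendant-backNeighbour dy q<y
      (backNeighbours-adjacent (k≤descendant dp) y<p q<p p~y p~q (Finₚ.<⇒≢ q<y ∘ ≡-sym))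
    ... | tri> _ _ y<q  = inj₂ (extend y<q
      (sym G (backNeighbours-adjacent (k≤descendant dp) y<p q<p p~y p~q (Finₚ.<⇒≢ y<q))) dy)

    descendant-neighbour : ∀ {p q} → Descendant p → Adj G (v p) (v q) → ¬ V (v q) → Descendant q
    descendant-neighbour {p} {q} dp p~q ¬Vq with Finₚ.<-cmp q p
    ... | tri< q<p _ _ = fromInj₂ (λ Vq → contradiction Vq ¬Vq) (descendant-backNeighbour dp q<p p~q)
    ... | tri≈ _ refl _ = contradiction p~q (irrefl G)
    ... | tri> _ _ p<q = extend p<q (sym G p~q) dp

    walk-descendant : ∀ {x y} → WalkAvoid G V x y → Descendant (position x) → Descendant (position y)
    walk-descendant (here _)           dx = dx
    walk-descendant (there _ x~y walk) dx = walk-descendant walk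
      (descendant-neighbour dx (Adj-position x~y)
        (walkAvoid-source walk ∘ subst V (v-position _)))

    branch-descendant : ∀ {x} → B∖V x → Descendant (position x)
    branch-descendant (inj₁ Vx , ¬Vx) = contradiction Vx ¬Vx
    branch-descendant (inj₂ walk , _) =
      walk-descendant walk (subst Descendant (≡-sym (position-v i)) root)

    module BranchOrdering (s : ℕ) (π : Fin (suc s) → Fin n)
      (π-mono : ∀ a b → a Fin.< b → π a Fin.< π b)
      (π-enumerates : ∀ p → ((∃ λ ℓ → π ℓ ≡ p) → B∖V (v p)) × (B∖V (v p) → ∃ λ ℓ → π ℓ ≡ p))
      where

      π-inBranch : ∀ ℓ → B∖V (v (π ℓ))
      π-inBranch ℓ = proj₁ (π-enumerates (π ℓ)) (ℓ , refl)

      inBranch-π : ∀ {p} → B∖V (v p) → ∃ λ ℓ → π ℓ ≡ p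
      inBranch-π = proj₂ (π-enumerates _)

      π-descendant : ∀ ℓ → Descendant (π ℓ)
      π-descendant ℓ = subst Descendant (position-v (π ℓ)) (branch-descendant (π-inBranch ℓ))

      π-late : ∀ ℓ → toℕ i ≤ toℕ (π ℓ)
      π-late ℓ = descendant-late (π-descendant ℓ)

      k≤π : ∀ ℓ → k ≤ toℕ (π ℓ)
      k≤π ℓ = k≤descendant (π-descendant ℓ)

      π-reflects-< : ∀ {a b} → π a Fin.< π b → a Fin.< b
      π-reflects-< {a} {b} πa<πb with Finₚ.<-cmp a b
      ... | tri< a<b _ _  = a<b
      ... | tri≈ _ refl _ = contradiction πa<πb (ℕ.<-irrefl refl)
      ... | tri> _ _ b<a  = contradiction (π-mono b a b<a) (ℕ.<-asym πa<πb)

      π-zero-least : ∀ ℓ → toℕ (π Fin.zero) ≤ toℕ (π ℓ)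
      π-zero-least Fin.zero    = ℕ.≤-refl
      π-zero-least (Fin.suc ℓ) = ℕ.<⇒≤ (π-mono Fin.zero (Fin.suc ℓ) z<s)

      π-zero : π Fin.zero ≡ i
      π-zero with ℓ , πℓ≡i ← inBranch-π (inj₂ (here ¬V[vi]) , ¬V[vi]) =
        Finₚ.toℕ-injective (ℕ.≤-antisym (subst (λ p → toℕ (π Fin.zero) ≤ toℕ p) πℓ≡i (π-zero-least ℓ))
                                         (π-late Fin.zero))

      EarlierNbhd : Fin (suc s) → VSet n
      EarlierNbhd j x = NB G V (v i) (v (π j)) x × (V x ⊎ ∃ λ ℓ → ℓ Fin.< j × x ≡ v (π ℓ))

      backNbhd-π : ∀ j {x} → BackNbhd G v (π j) x → V x ⊎ ∃ λ ℓ → ℓ Fin.< j × x ≡ v (π ℓ)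
      backNbhd-π j (πj~x , q , q<πj , refl) with V? (v q)
      ... | yes Vq = inj₁ Vq
      ... | no ¬Vq with ℓ , refl ← inBranch-π (branch-extend (π-inBranch j) πj~x ¬Vq) =
        inj₂ (ℓ , π-reflects-< q<πj , refl)

      earlierNbhd⇒backNbhd : ∀ j {x} → EarlierNbhd j x → BackNbhd G v (π j) x
      earlierNbhd⇒backNbhd j ((πj~x , _) , inj₁ (_ , q , q<i , x≡vq)) =
        πj~x , q , ℕ.<-≤-trans q<i (π-late j) , x≡vq
      earlierNbhd⇒backNbhd j ((πj~x , _) , inj₂ (ℓ , ℓ<j , x≡πℓ)) =
        πj~x , π ℓ , π-mono ℓ j ℓ<j , x≡πℓ

      backNbhd⇒earlierNbhd : ∀ j {x} → BackNbhd G v (π j) x → EarlierNbhd j x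
      backNbhd⇒earlierNbhd j back@(πj~x , _) with backNbhd-π j back
      ... | inj₁ Vx               = (πj~x , inj₁ Vx) , inj₁ Vx
      ... | inj₂ (ℓ , ℓ<j , refl) = (πj~x , proj₁ (π-inBranch ℓ)) , inj₂ (ℓ , ℓ<j , refl)

      earlierNbhd-card : ∀ j → Card (EarlierNbhd j) k
      earlierNbhd-card j =
        Card-cong (backNbhd⇒earlierNbhd j) (earlierNbhd⇒backNbhd j)
          (proj₁ (step (π j) (k≤π j)))

      Common : ℕ → VSet n
      Common = CommonNbhd G V (v i) (λ ℓ → v (π ℓ))

      common-extend : ∀ j {x} → Common (pred (toℕ j)) x → Adj G (v (π j)) x → Common (toℕ j) x
      common-extend j {x} (Vx , x∈N) πj~x = Vx , x∈N′
        where
        x∈N′ : ∀ ℓ → 1 ≤ toℕ ℓ → toℕ ℓ ≤ toℕ j → NB G V (v i) (v (π ℓ)) x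
        x∈N′ ℓ 1≤ℓ ℓ≤j with ℕ.m≤n⇒m<n∨m≡n ℓ≤j
        ... | inj₁ ℓ<j = x∈N ℓ 1≤ℓ (ℕ.<⇒≤pred ℓ<j)
        ... | inj₂ ℓ≡j with refl ← Finₚ.toℕ-injective ℓ≡j = πj~x , inj₁ Vx

      common-nonNeighbour-adjacent : ∀ j {x z} → Common (pred (toℕ j)) x → ¬ Adj G (v (π j)) x →
        BackNbhd G v (π j) z → Adj G z x
      common-nonNeighbour-adjacent j (Vx , x∈N) ¬πj~x back with backNbhd-π j back
      ... | inj₁ Vz = V-adjacent Vz Vx λ { refl → ¬πj~x (proj₁ back) }
      ... | inj₂ (Fin.zero , _ , refl) = subst (λ p → Adj G (v p) _) (≡-sym π-zero) (proj₁ Vx)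
      ... | inj₂ (Fin.suc ℓ , ℓ<j , refl) = proj₁ (x∈N (Fin.suc ℓ) z<s (ℕ.<⇒≤pred ℓ<j))

      common-nonNeighbour-unique : ∀ j {x y} → Common (pred (toℕ j)) x → Common (pred (toℕ j)) y →
        ¬ Adj G (v (π j)) x → ¬ Adj G (v (π j)) y → x ≡ y
      common-nonNeighbour-unique j {x} {y} Cx Cy ¬πj~x ¬πj~y
        with (K , K! , K-mem , K-len) , K-adj ← step (π j) (k≤π j) =
        decidable-stable (x ≟ y) λ x≢y →
          ℕ.1+n≰n (subst (λ m → suc (suc m) ≤ suc k) K-len (clique-length≤ (x∷y∷K-clique x≢y)))
        where
        K⊆back : ∀ {z} → z ∈ K → BackNbhd G v (π j) z
        K⊆back z∈K = proj₂ (K-mem _) z∈K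

        x∷y∷K-clique : x ≢ y → AllPairs (Adj G) (x ∷ y ∷ K)
        x∷y∷K-clique x≢y =
          (V-adjacent (proj₁ Cx) (proj₁ Cy) x≢y
            ∷ All.tabulate (sym G ∘ common-nonNeighbour-adjacent j Cx ¬πj~x ∘ K⊆back))
          ∷ All.tabulate (sym G ∘ common-nonNeighbour-adjacent j Cy ¬πj~y ∘ K⊆back)
          ∷ pairwise⇒AllPairs K! (λ z∈K w∈K → K-adj _ _ (K⊆back z∈K) (K⊆back w∈K))

      common-card-step : ∀ j {a b} → Card (Common (toℕ j)) a → Card (Common (pred (toℕ j))) b →
        b ≤ suc a
      common-card-step j (as , _ , as-mem , refl) (bs , bs! , bs-mem , refl) =
        ⊆-but-one⇒length≤suc (adj? G (v (π j))) bs!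
          (λ x∈bs y∈bs → common-nonNeighbour-unique j (proj₂ (bs-mem _) x∈bs) (proj₂ (bs-mem _) y∈bs))
          (λ x∈bs πj~x → proj₁ (as-mem _) (common-extend j (proj₂ (bs-mem _) x∈bs) πj~x))

lemma2p2 : (k n : ℕ) → 1 ≤ k → (G : Graph n) → (v : Fin n → Fin n) →
  AdditionOrdering k G v →
  (i : Fin n) → k ≤ toℕ i →
  (s : ℕ) → (π : Fin (suc s) → Fin n) →
  (∀ a b → a Fin.< b → π a Fin.< π b) →
  (∀ p → ((∃ λ ℓ → π ℓ ≡ p) → BranchV G (BackNbhd G v i) (v i) (v p) × ¬ BackNbhd G v i (v p))
       × (BranchV G (BackNbhd G v i) (v i) (v p) × ¬ BackNbhd G v i (v p) → ∃ λ ℓ → π ℓ ≡ p)) →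
  (v (π Fin.zero) ≡ v i)
  × (∀ (j : Fin (suc s)) → 1 ≤ toℕ j →
       Card (λ x → NB G (BackNbhd G v i) (v i) (v (π j)) x
                   × (BackNbhd G v i x ⊎ ∃ λ ℓ → ℓ Fin.< j × x ≡ v (π ℓ))) k)
  × (∀ (j : Fin (suc s)) → 1 ≤ toℕ j → (a b : ℕ) →
       Card (CommonNbhd G (BackNbhd G v i) (v i) (λ ℓ → v (π ℓ)) (toℕ j)) a →
       Card (CommonNbhd G (BackNbhd G v i) (v i) (λ ℓ → v (π ℓ)) (pred (toℕ j))) b →
       b ≤ suc a)
lemma2p2 k n _ G v ordering i k≤i s π π-mono π-enumerates =
  cong v π-zero , (λ j _ → earlierNbhd-card j) , (λ j _ _ _ → common-card-step j)
  where
  open KTree ordering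
  open Branch i k≤i
  open BranchOrdering s π π-mono π-enumerates
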